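{- Let $b\ge 2$, $m\ge1$ be integers with $m\nmid(b-1)$, $\Sigma$ an alphabet with $m$ letters, $\sigma$ a cyclic permutation of $\Sigma$ (a single $m$-cycle), $\overline{\alpha}\in\Sigma$, and $\mathbf{t}$ the corresponding generalized Thue–Morse word, with critical exponent $e=E(\mathbf{t})$. Let $w$ be a critical factor of $\mathbf{t}$ of length $\ell$ with $b\nmid\ell$. (i) If $b>m$, then $\ell=m$ and every occurrence of $w^e$ in $\mathbf{t}$ is the concatenation $\beta_1\beta_2$ of two consecutive blocks (i.e., starts at a position divisible by $b$ and has length $2b$). (ii) If $b\le m$, write $w^2=w^{(1)}w^{(2)}$ with $w^{(1)}=w^{(2)}=w$; then in every occurrence of $w^2$ in $\mathbf{t}$, the factor $w^{(2)}$ begins at the beginning of a block (at a position divisible by $b$).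
   Context: $\mu(\alpha)=\alpha\,\sigma(\alpha)\cdots\sigma^{b-1}(\alpha)$, $\mathbf{t}=\lim_n\mu^n(\overline{\alpha})=\mathbf{t}[0]\mathbf{t}[1]\cdots$. Blocks of $\mathbf{t}$ are the factors $\mathbf{t}[jb]\cdots\mathbf{t}[jb+b-1]$, $j\ge0$. For a nonempty word $w$ and rational $r>0$ with $r|w|\in\mathbb N$, $w^r=w^{\lfloor r\rfloor}p$ with $p$ the prefix of $w$ of length $(r-\lfloor r\rfloor)|w|$; $\textsc{Index}(w)=\max\{r\in\mathbb Q: w^r\text{ factor of }\mathbf{t}\}$; $E(\mathbf{t})=\sup\textsc{Index}(w)$ over nonempty factors; a critical factor is a nonempty factor with $\textsc{Index}(w)=E(\mathbf{t})$. -}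

module Defs where

open import Data.Nat using (ℕ; zero; suc; _+_; _*_; _<_; _≤_)
open import Data.Fin using (Fin)
open import Data.List using (List; []; _∷_; length; concatMap; map; upTo)
open import Data.Maybe using (Maybe; just; nothing; fromMaybe)
open import Data.Product using (∃; _×_)
open import Function using (_∘_)
open import Relation.Binary.PropositionalEquality using (_≡_)

iter : {A : Set} → (A → A) → ℕ → A → A
iter f zero    x = x
iter f (suc k) x = f (iter f k x)

at : {A : Set} → List A → ℕ → Maybe A
at []       _       = nothing
at (x ∷ _)  zero    = just x
at (_ ∷ xs) (suc k) = at xs k

-- σ : Fin m → Fin m is a cyclic permutation (a single m-cycle):
-- injective, and every letter lies in the orbit of every other.
IsCyclicPerm : {m : ℕ} → (Fin m → Fin m) → Set
IsCyclicPerm {m} σ =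
  (∀ x y → σ x ≡ σ y → x ≡ y) × (∀ x y → ∃ λ k → iter σ k x ≡ y)

μ : {m : ℕ} → ℕ → (Fin m → Fin m) → List (Fin m) → List (Fin m)
μ b σ = concatMap (λ a → map (λ i → iter σ i a) (upTo b))

-- the generalized Thue–Morse word t = lim μ^n(ᾱ), as a map ℕ → Σ:
-- t[n] is the n-th letter of μ^(n+1)(ᾱ) (which has length b^(n+1) > n for b ≥ 2,
-- and μ^k(ᾱ) is a prefix of μ^(k+1)(ᾱ)); the default ᾱ is never used when b ≥ 2.
tm : {m : ℕ} → ℕ → (Fin m → Fin m) → Fin m → ℕ → Fin m
tm b σ α n = fromMaybe α (at (iter (μ b σ) (suc n) (α ∷ [])) n)

-- w^r occurs in t at position i, where L = r|w| is the length of w^r: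
-- the letters t[i], …, t[i+L-1] follow w periodically (w^r is the length-L
-- prefix of w w w ⋯).
OccursPow : {m : ℕ} → (ℕ → Fin m) → List (Fin m) → ℕ → ℕ → Set
OccursPow t w L i =
  ∀ q r → r < length w → q * length w + r < L → at w r ≡ just (t (i + (q * length w + r)))

IsPowFactor : {m : ℕ} → (ℕ → Fin m) → List (Fin m) → ℕ → Set
IsPowFactor t w L = ∃ λ i → OccursPow t w L i

-- w is a critical factor of t with critical exponent e = E(t) = L / |w|:
-- w is a nonempty factor, w^(L/|w|) is a factor (L ≥ 1), and for every nonempty
-- factor v and every L' ≥ 1 with v^(L'/|v|) a factor, L'/|v| ≤ L/|w|.
-- (So Index(w) = L/|w| = E(t), the supremum being attained.)
IsCritical : {m : ℕ} → (ℕ → Fin m) → List (Fin m) → ℕ → Set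
IsCritical t w L =
  1 ≤ length w × IsPowFactor t w (length w) × 1 ≤ L × IsPowFactor t w L ×
  (∀ (v : List _) L' → 1 ≤ length v → 1 ≤ L' → IsPowFactor t v L' →
     L' * length w ≤ L * length v)

module Submission where

-- Since t = μ(t), consecutive letters inside a block differ by one application of σ
-- (a "step"), while the boundary after block k is a step only if t[k+1] = σᵇ(t[k]);
-- as m ∤ b - 1, two consecutive boundaries are never both steps. In an occurrence of a
-- factor with period p and b ∤ p, positions p apart cannot both be boundaries, so
-- periodicity carries steps to every position once the occurrence is long enough. Then
-- the occurrence reads y σ(y) σ²(y) ⋯, hence m ∣ p, and it spans at most two blocks.
-- Two blocks joined by a step form the power (y σ(y) ⋯ σ^(m-1)(y))^(2b/m), so
-- criticality gives 2b·|w| ≤ L·m. For b > m this forces |w| = m, L = 2b and an aligned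
-- start. For b ≤ m, if the midpoint of w² is not a block start, the position just before
-- it is a step; then all of w² is steps, so |w| ≥ m ≥ b and w² cannot fit in two blocks.

open import Defs
open import Data.Nat using (ℕ; zero; suc; pred; _+_; _*_; _∸_; _^_; _≤_; _<_; z≤n; s≤s; NonZero; >-nonZero; >-nonZero⁻¹)
open import Data.Nat.Properties
open import Data.Nat.DivMod using (_/_; _%_; m≡m%n+[m/n]*n; m%n<n)
open import Data.Nat.Divisibility using (_∣_; _∤_; divides; ∣⇒≤; _∣?_; _∣0; n∣m*n; ∣m+n∣m⇒∣n; m%n≡0⇒n∣m)
open import Data.Fin using (Fin; toℕ; fromℕ<)
open import Data.Fin.Properties using (toℕ-fromℕ<; toℕ<n; injective⇒≤; pigeonhole)
open import Data.List using (List; []; _∷_; length; map; upTo; applyUpTo; _++_)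
open import Data.List.Properties using (length-map; length-upTo; length-++)
open import Data.Maybe using (just; fromMaybe)
import Data.Maybe as Maybe
open import Data.Maybe.Properties using (just-injective)
open import Data.Product using (_×_; _,_; proj₁; proj₂; ∃)
open import Data.Sum using (_⊎_; inj₁; inj₂)
open import Data.Empty using (⊥-elim)
open import Relation.Nullary using (¬_; yes; no)
open import Relation.Binary.PropositionalEquality
open import Relation.Binary using (tri<; tri≈; tri>)
open import Function using (_∘_; _$_; id)
open import Data.Nat.Tactic.RingSolver using (solve-∀)

data QuotRem (k : ℕ) : ℕ → Set where
  quotRem : ∀ q r → r < k → QuotRem k (q * k + r)

quotRem-view : ∀ k .{{_ : NonZero k}} n → QuotRem k n
quotRem-view k n = subst (QuotRem k) n≡qk+r (quotRem (n / k) (n % k) (m%n<n n k))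
  where
  n≡qk+r : n / k * k + n % k ≡ n
  n≡qk+r = trans (+-comm (n / k * k) (n % k)) (sym (m≡m%n+[m/n]*n n k))

module _ {A : Set} (f : A → A) where

  iter-+ : ∀ a c x → iter f (a + c) x ≡ iter f a (iter f c x)
  iter-+ zero    c x = refl
  iter-+ (suc a) c x = cong f (iter-+ a c x)

  iter-injective : (∀ x y → f x ≡ f y → x ≡ y) → ∀ k {x y} → iter f k x ≡ iter f k y → x ≡ y
  iter-injective inj zero    e = e
  iter-injective inj (suc k) e = iter-injective inj k (inj _ _ e)

  iter-periodic : ∀ k x → iter f k x ≡ x → ∀ q r → iter f (q * k + r) x ≡ iter f r x
  iter-periodic k x fix zero    r = refl
  iter-periodic k x fix (suc q) r = begin
    iter f (k + q * k + r) x         ≡⟨ cong (λ n → iter f n x) (+-assoc k (q * k) r) ⟩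
    iter f (k + (q * k + r)) x       ≡⟨ cong (λ n → iter f n x) (+-comm k (q * k + r)) ⟩
    iter f (q * k + r + k) x         ≡⟨ iter-+ (q * k + r) k x ⟩
    iter f (q * k + r) (iter f k x)  ≡⟨ cong (iter f (q * k + r)) fix ⟩
    iter f (q * k + r) x             ≡⟨ iter-periodic k x fix q r ⟩
    iter f r x                       ∎
    where open ≡-Reasoning

module _ {A : Set} where

  _≼_ : List A → List A → Set
  xs ≼ ys = ∀ n {x} → at xs n ≡ just x → at ys n ≡ just x

  at-++ʳ : ∀ (xs ys : List A) n → at (xs ++ ys) (length xs + n) ≡ at ys n
  at-++ʳ []       ys n = refl
  at-++ʳ (x ∷ xs) ys n = at-++ʳ xs ys n

  at-++ˡ : ∀ (xs ys : List A) {n} → n < length xs → at (xs ++ ys) n ≡ at xs n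
  at-++ˡ (x ∷ xs) ys {zero}  _         = refl
  at-++ˡ (x ∷ xs) ys {suc n} (s≤s n<l) = at-++ˡ xs ys n<l

  at-applyUpTo : ∀ (f : ℕ → A) {k n} → n < k → at (applyUpTo f k) n ≡ just (f n)
  at-applyUpTo f {suc k} {zero}  _         = refl
  at-applyUpTo f {suc k} {suc n} (s≤s n<k) = at-applyUpTo (f ∘ suc) n<k

  at-<length : ∀ (xs : List A) n d → n < length xs → at xs n ≡ just (fromMaybe d (at xs n))
  at-<length (x ∷ xs) zero    d _         = refl
  at-<length (x ∷ xs) (suc n) d (s≤s n<l) = at-<length xs n d n<l

at-map : ∀ {A B : Set} (f : A → B) xs n → at (map f xs) n ≡ Maybe.map f (at xs n)
at-map f []       n       = refl
at-map f (x ∷ xs) zero    = refl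
at-map f (x ∷ xs) (suc n) = at-map f xs n

module CyclicPerm {m : ℕ} (σ : Fin m → Fin m) (cyc : IsCyclicPerm σ) where

  private
    σ-injective = proj₁ cyc
    transitive  = proj₂ cyc

  -- Reducing the orbit index of z modulo k injects Fin m into Fin k.
  period-≥ : ∀ y k → 0 < k → iter σ k y ≡ y → m ≤ k
  period-≥ y k 0<k fix = injective⇒≤ {f = index} index-injective
    where
    instance _ = >-nonZero 0<k
    reduce : ℕ → Fin k
    reduce n with quotRem-view k n
    ... | quotRem q r r<k = fromℕ< r<k
    iter-reduce : ∀ n → iter σ (toℕ (reduce n)) y ≡ iter σ n y
    iter-reduce n with quotRem-view k n
    ... | quotRem q r r<k = begin
      iter σ (toℕ (fromℕ< r<k)) y ≡⟨ cong (λ n → iter σ n y) (toℕ-fromℕ< r<k) ⟩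
      iter σ r y                  ≡⟨ sym (iter-periodic σ k y fix q r) ⟩
      iter σ (q * k + r) y        ∎
      where open ≡-Reasoning
    index : Fin m → Fin k
    index z = reduce (proj₁ (transitive y z))
    index-correct : ∀ z → iter σ (toℕ (index z)) y ≡ z
    index-correct z = trans (iter-reduce (proj₁ (transitive y z))) (proj₂ (transitive y z))
    index-injective : ∀ {z z'} → index z ≡ index z' → z ≡ z'
    index-injective {z} {z'} e =
      trans (sym (index-correct z)) (trans (cong (λ i → iter σ (toℕ i) y) e) (index-correct z'))

  period-≤ : ∀ y → ∃ λ d → 0 < d × d ≤ m × iter σ d y ≡ y
  period-≤ y with pigeonhole (n<1+n m) (λ j → iter σ (toℕ j) y)
  ... | i , j , i<j , σⁱy≡σʲy = d , m<n⇒0<n∸m i<j , d≤m , σᵈy≡y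
    where
    d = toℕ j ∸ toℕ i
    d≤m : d ≤ m
    d≤m = ≤-trans (m∸n≤m (toℕ j) (toℕ i)) (≤-pred (toℕ<n j))
    σᵈy≡y : iter σ d y ≡ y
    σᵈy≡y = sym (iter-injective σ σ-injective (toℕ i) (begin
      iter σ (toℕ i) y            ≡⟨ σⁱy≡σʲy ⟩
      iter σ (toℕ j) y            ≡⟨ cong (λ n → iter σ n y) (sym (m+[n∸m]≡n (<⇒≤ i<j))) ⟩
      iter σ (toℕ i + d) y        ≡⟨ iter-+ σ (toℕ i) d y ⟩
      iter σ (toℕ i) (iter σ d y) ∎))
      where open ≡-Reasoning

  iter-order : ∀ y → iter σ m y ≡ y
  iter-order y with period-≤ y
  ... | d , 0<d , d≤m , σᵈy≡y =
    subst (λ n → iter σ n y ≡ y) (≤-antisym d≤m (period-≥ y d 0<d σᵈy≡y)) σᵈy≡y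

  iter-fixed⇒∣ : ∀ y k → iter σ k y ≡ y → m ∣ k
  iter-fixed⇒∣ y k σᵏy≡y with quotRem-view m {{>-nonZero (≤-<-trans z≤n (toℕ<n y))}} k
  ... | quotRem q zero    _   = divides q (+-identityʳ (q * m))
  ... | quotRem q (suc r) r<m = ⊥-elim (<⇒≱ r<m (period-≥ y (suc r) (s≤s z≤n)
          (trans (sym (iter-periodic σ m y (iter-order y) q (suc r))) σᵏy≡y)))

  orbit : Fin m → List (Fin m)
  orbit y = map (λ r → iter σ r y) (upTo m)

  length-orbit : ∀ y → length (orbit y) ≡ m
  length-orbit y = trans (length-map _ (upTo m)) (length-upTo m)

  at-orbit : ∀ y {r} → r < m → at (orbit y) r ≡ just (iter σ r y)
  at-orbit y {r} r<m = trans (at-map _ (upTo m) r) (cong (Maybe.map _) (at-applyUpTo id r<m))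

n<b^n : ∀ {b} → 2 ≤ b → ∀ n → n < b ^ n
n<b^n         2≤b zero    = s≤s z≤n
n<b^n {b} 2≤b (suc n) = begin-strict
  suc n           ≤⟨ n<b^n 2≤b n ⟩
  b ^ n           <⟨ m<m+n (b ^ n) (m^n>0 b n) ⟩
  b ^ n + b ^ n   ≡⟨ cong (b ^ n +_) (sym (+-identityʳ (b ^ n))) ⟩
  2 * b ^ n       ≤⟨ *-monoˡ-≤ (b ^ n) 2≤b ⟩
  b * b ^ n       ∎
  where
  instance _ = >-nonZero (≤-trans (s≤s z≤n) 2≤b)
  open ≤-Reasoning

-- t = μ(t) read letterwise: block q of t, i.e. t[qb] ⋯ t[qb + b - 1], is μ(t[q]).
IsFixedPointOfμ : {m : ℕ} → ℕ → (Fin m → Fin m) → (ℕ → Fin m) → Set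
IsFixedPointOfμ b σ t = ∀ q d → d < b → t (q * b + d) ≡ iter σ d (t q)

module _ {m : ℕ} (b : ℕ) .{{_ : NonZero b}} (σ : Fin m → Fin m) where

  private
    block : Fin m → List (Fin m)
    block a = map (λ i → iter σ i a) (upTo b)

    length-block : ∀ a → length (block a) ≡ b
    length-block a = trans (length-map _ (upTo b)) (length-upTo b)

    at-block : ∀ a {d} → d < b → at (block a) d ≡ just (iter σ d a)
    at-block a {d} d<b = trans (at-map _ (upTo b) d) (cong (Maybe.map _) (at-applyUpTo id d<b))

  at-μ : ∀ w q {d} → d < b → at (μ b σ w) (q * b + d) ≡ Maybe.map (iter σ d) (at w q)
  at-μ []      q       d<b = refl
  at-μ (a ∷ w) zero    d<b =
    trans (at-++ˡ (block a) _ (subst (_ <_) (sym (length-block a)) d<b)) (at-block a d<b)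
  at-μ (a ∷ w) (suc q) {d} d<b = begin
    at (block a ++ μ b σ w) (b + q * b + d)                   ≡⟨ cong (at (block a ++ μ b σ w)) index-shift ⟩
    at (block a ++ μ b σ w) (length (block a) + (q * b + d)) ≡⟨ at-++ʳ (block a) _ _ ⟩
    at (μ b σ w) (q * b + d)                                  ≡⟨ at-μ w q d<b ⟩
    Maybe.map (iter σ d) (at w q)                             ∎
    where
    open ≡-Reasoning
    index-shift : b + q * b + d ≡ length (block a) + (q * b + d)
    index-shift = trans (+-assoc b (q * b) d) (cong (_+ (q * b + d)) (sym (length-block a)))

  length-μ : ∀ w → length (μ b σ w) ≡ length w * b
  length-μ []      = refl
  length-μ (a ∷ w) = trans (length-++ (block a)) (cong₂ _+_ (length-block a) (length-μ w))

  μ-mono : ∀ {xs ys} → xs ≼ ys → μ b σ xs ≼ μ b σ ys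
  μ-mono {xs} {ys} xs≼ys n e with quotRem-view b n
  ... | quotRem q d d<b with at xs q in eq | trans (sym (at-μ xs q d<b)) e
  ...   | just z | refl = trans (at-μ ys q d<b) (cong (Maybe.map (iter σ d)) (xs≼ys q eq))

  module _ (α : Fin m) where

    prefix : ℕ → List (Fin m)
    prefix k = iter (μ b σ) k (α ∷ [])

    length-prefix : ∀ k → length (prefix k) ≡ b ^ k
    length-prefix zero    = refl
    length-prefix (suc k) =
      trans (length-μ (prefix k)) (trans (cong (_* b) (length-prefix k)) (*-comm (b ^ k) b))

    prefix-≼-suc : ∀ k → prefix k ≼ prefix (suc k)
    prefix-≼-suc zero    zero refl = at-μ (α ∷ []) 0 (>-nonZero⁻¹ b)
    prefix-≼-suc (suc k)           = μ-mono {prefix k} {prefix (suc k)} (prefix-≼-suc k)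

    prefix-≼ : ∀ j k → prefix k ≼ prefix (j + k)
    prefix-≼ zero    k n e = e
    prefix-≼ (suc j) k n e = prefix-≼-suc (j + k) n (prefix-≼ j k n e)

    module _ (2≤b : 2 ≤ b) where

      at-prefix-tm : ∀ n → at (prefix (suc n)) n ≡ just (tm b σ α n)
      at-prefix-tm n = at-<length (prefix (suc n)) n α
        (subst (n <_) (sym (length-prefix (suc n))) (<-trans (n<1+n n) (n<b^n 2≤b (suc n))))

      tm-unique : ∀ k n {x} → at (prefix k) n ≡ just x → tm b σ α n ≡ x
      tm-unique k n {x} e = just-injective (begin
        just (tm b σ α n)             ≡⟨ sym (prefix-≼ k (suc n) n (at-prefix-tm n)) ⟩
        at (prefix (k + suc n)) n     ≡⟨ cong (λ j → at (prefix j) n) (+-comm k (suc n)) ⟩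
        at (prefix (suc n + k)) n     ≡⟨ prefix-≼ (suc n) k n e ⟩
        just x                        ∎)
        where open ≡-Reasoning

      tm-fixedPoint : IsFixedPointOfμ b σ (tm b σ α)
      tm-fixedPoint q d d<b = tm-unique (suc (suc q)) (q * b + d)
        (trans (at-μ (prefix (suc q)) q d<b) (cong (Maybe.map (iter σ d)) (at-prefix-tm q)))

Periodic : {A : Set} → (ℕ → A) → ℕ → ℕ → ℕ → Set
Periodic t i L p = ∀ j → j + p < L → t (i + j) ≡ t (i + (j + p))

occursPow⇒periodic : ∀ {m} (t : ℕ → Fin m) w L i → OccursPow t w L i → Periodic t i L (length w)
occursPow⇒periodic t []      L i occ j _ = cong (λ n → t (i + n)) (sym (+-identityʳ j))
occursPow⇒periodic t (a ∷ w) L i occ j j+p<L with quotRem-view (length (a ∷ w)) j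
... | quotRem q r r<p = just-injective (begin
  just (t (i + (q * p + r)))     ≡⟨ sym (occ q r r<p first<L) ⟩
  at (a ∷ w) r                   ≡⟨ occ (suc q) r r<p second<L ⟩
  just (t (i + (suc q * p + r))) ≡⟨ cong (λ n → just (t (i + n))) (sym (shift q p r)) ⟩
  just (t (i + (q * p + r + p))) ∎)
  where
  open ≡-Reasoning
  p = length (a ∷ w)
  shift : ∀ q p r → q * p + r + p ≡ suc q * p + r
  shift = solve-∀
  first<L : q * p + r < L
  first<L = ≤-<-trans (m≤m+n (q * p + r) p) j+p<L
  second<L : suc q * p + r < L
  second<L = subst (_< L) (shift q p r) j+p<L

module FixedPoint {m : ℕ} (σ : Fin m → Fin m) (cyc : IsCyclicPerm σ)
                  (b' : ℕ) (m∤b' : m ∤ b') (t : ℕ → Fin m) (fix : IsFixedPointOfμ (suc b') σ t) where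

  open CyclicPerm σ cyc

  b : ℕ
  b = suc b'

  Step : ℕ → Set
  Step n = t (suc n) ≡ σ (t n)

  StepsOn : ℕ → ℕ → Set
  StepsOn i L = ∀ j → suc j < L → Step (i + j)

  private
    instance
      m-nonZero : NonZero m
      m-nonZero = >-nonZero (≤-<-trans z≤n (toℕ<n (t 0)))

    -- b - 1 = 0 would be divisible by m.
    1<b : 1 < b
    1<b = s≤s (n≢0⇒n>0 λ { refl → m∤b' (m ∣0) })

    next-block : ∀ k → suc (k * b + b') ≡ suc k * b + 0
    next-block k = identity k b'
      where
      identity : ∀ k c → suc (k * suc c + c) ≡ suc k * suc c + 0
      identity = solve-∀

  step-interior : ∀ q d → suc d < b → Step (q * b + d)
  step-interior q d 1+d<b = begin
    t (suc (q * b + d))   ≡⟨ cong t (sym (+-suc (q * b) d)) ⟩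
    t (q * b + suc d)     ≡⟨ fix q (suc d) 1+d<b ⟩
    σ (iter σ d (t q))    ≡⟨ cong σ (sym (fix q d (<-trans (n<1+n d) 1+d<b))) ⟩
    σ (t (q * b + d))     ∎
    where open ≡-Reasoning

  step-or-boundary : ∀ n → Step n ⊎ ∃ λ k → n ≡ k * b + b'
  step-or-boundary n with quotRem-view b n
  ... | quotRem q d d<b with suc d <? b
  ...   | yes 1+d<b = inj₁ (step-interior q d 1+d<b)
  ...   | no  1+d≮b = inj₂ (q , cong (q * b +_) (≤-antisym (≤-pred d<b) (≤-pred (≮⇒≥ 1+d≮b))))

  -- A step across the boundary after block k means t[k+1] = σᵇ(t[k]); a step at k
  -- as well would make t[k] a fixed point of σ^(b-1), impossible as m ∤ b - 1.
  boundary-step⇒¬step : ∀ k → Step (k * b + b') → ¬ Step k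
  boundary-step⇒¬step k boundary-step step =
    m∤b' (iter-fixed⇒∣ (t k) b' (sym (proj₁ cyc _ _ σtk≡σᵇtk)))
    where
    open ≡-Reasoning
    σtk≡σᵇtk : σ (t k) ≡ σ (iter σ b' (t k))
    σtk≡σᵇtk = begin
      σ (t k)               ≡⟨ sym step ⟩
      t (suc k)             ≡⟨ sym (fix (suc k) 0 (s≤s z≤n)) ⟩
      t (suc k * b + 0)     ≡⟨ cong t (sym (next-block k)) ⟩
      t (suc (k * b + b'))  ≡⟨ boundary-step ⟩
      σ (t (k * b + b'))    ≡⟨ cong σ (fix k b' ≤-refl) ⟩
      σ (iter σ b' (t k))   ∎

  no-consecutive-boundary-steps : ∀ k → Step (k * b + b') → ¬ Step (suc k * b + b')
  no-consecutive-boundary-steps k step₁ step₂ with step-or-boundary k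
  ... | inj₁ step-k        = boundary-step⇒¬step k step₁ step-k
  ... | inj₂ (k' , refl) = boundary-step⇒¬step (suc k) step₂
          (subst Step (sym (next-block k')) (step-interior (suc k') 0 1<b))

  module _ {i L p : ℕ} (per : Periodic t i L p) where

    step-periodic : ∀ j → j + suc p < L → Step (i + j) ≡ Step (i + (j + p))
    step-periodic j j+1+p<L = cong₂ (λ next here → next ≡ σ here) next-equal here-equal
      where
      open ≡-Reasoning
      here-equal : t (i + j) ≡ t (i + (j + p))
      here-equal = per j (≤-<-trans (+-monoʳ-≤ j (n≤1+n p)) j+1+p<L)
      next-equal : t (suc (i + j)) ≡ t (suc (i + (j + p)))
      next-equal = begin
        t (suc (i + j))        ≡⟨ cong t (sym (+-suc i j)) ⟩
        t (i + suc j)          ≡⟨ per (suc j) (subst (_< L) (+-suc j p) j+1+p<L) ⟩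
        t (i + suc (j + p))    ≡⟨ cong t (+-suc i (j + p)) ⟩
        t (suc (i + (j + p)))  ∎

    -- Two boundaries are b apart, so if b ∤ p at most one of i + j, i + j + p is a boundary,
    -- and periodicity carries the step from the other one.
    periodic-step-pair : b ∤ p → ∀ j → j + suc p < L → Step (i + j) × Step (i + (j + p))
    periodic-step-pair b∤p j j+1+p<L with step-or-boundary (i + j) | step-or-boundary (i + (j + p))
    ... | inj₁ step | _        = step , subst id (step-periodic j j+1+p<L) step
    ... | inj₂ _    | inj₁ step = subst id (sym (step-periodic j j+1+p<L)) step , step
    ... | inj₂ (k , e) | inj₂ (k₂ , e₂) = ⊥-elim (b∤p (∣m+n∣m⇒∣n (divides k₂ kb+p≡k₂b) (n∣m*n k)))
      where
      kb+p≡k₂b : k * b + p ≡ k₂ * b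
      kb+p≡k₂b = +-cancelʳ-≡ b' _ _ (begin
        k * b + p + b'     ≡⟨ +-right-comm (k * b) p b' ⟩
        k * b + b' + p     ≡⟨ cong (_+ p) (sym e) ⟩
        i + j + p          ≡⟨ +-assoc i j p ⟩
        i + (j + p)        ≡⟨ e₂ ⟩
        k₂ * b + b'        ∎)
        where
        open ≡-Reasoning
        +-right-comm : ∀ x y z → x + y + z ≡ x + z + y
        +-right-comm = solve-∀

    periodic-steps : b ∤ p → (∀ j → j < p → L ≤ j + suc p → Step (i + j)) → StepsOn i L
    periodic-steps b∤p near-end j 1+j<L with j + suc p <? L
    ... | yes j+1+p<L = proj₁ (periodic-step-pair b∤p j j+1+p<L)
    ... | no  j+1+p≮L with j <? p
    ...   | yes j<p = near-end j j<p (≮⇒≥ j+1+p≮L)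
    ...   | no  j≮p = subst (λ n → Step (i + n)) (m∸n+n≡m (≮⇒≥ j≮p))
                        (proj₂ (periodic-step-pair b∤p (j ∸ p) (subst (_< L) shifted 1+j<L)))
      where
      shifted : suc j ≡ j ∸ p + suc p
      shifted = trans (cong suc (sym (m∸n+n≡m (≮⇒≥ j≮p)))) (sym (+-suc (j ∸ p) p))

  steps⇒iter : ∀ {i L} → StepsOn i L → ∀ j → j < L → t (i + j) ≡ iter σ j (t i)
  steps⇒iter {i} steps zero    _     = cong t (+-identityʳ i)
  steps⇒iter {i} steps (suc j) 1+j<L = begin
    t (i + suc j)        ≡⟨ cong t (+-suc i j) ⟩
    t (suc (i + j))      ≡⟨ steps j 1+j<L ⟩
    σ (t (i + j))        ≡⟨ cong σ (steps⇒iter steps j (<-trans (n<1+n j) 1+j<L)) ⟩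
    σ (iter σ j (t i))   ∎
    where open ≡-Reasoning

  steps⇒m∣period : ∀ {i L p} → StepsOn i L → Periodic t i L p → p < L → m ∣ p
  steps⇒m∣period {i} {L} {p} steps per p<L = iter-fixed⇒∣ (t i) p (begin
    iter σ p (t i)   ≡⟨ sym (steps⇒iter steps p p<L) ⟩
    t (i + p)        ≡⟨ sym (per 0 p<L) ⟩
    t (i + 0)        ≡⟨ cong t (+-identityʳ i) ⟩
    t i              ∎)
    where open ≡-Reasoning

  steps⇒orbit-power : ∀ {i L} → StepsOn i L → OccursPow t (orbit (t i)) L i
  steps⇒orbit-power {i} {L} steps q r r<len qm+r<L = begin
    at (orbit (t i)) r                 ≡⟨ at-orbit (t i) r<m ⟩
    just (iter σ r (t i))              ≡⟨ cong just (sym (iter-periodic σ m (t i) (iter-order (t i)) q r)) ⟩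
    just (iter σ (q * m + r) (t i))    ≡⟨ cong just (sym (steps⇒iter steps (q * m + r) qm+r<L′)) ⟩
    just (t (i + (q * m + r)))         ≡⟨ cong (λ n → just (t (i + (q * n + r)))) (sym |orbit|≡m) ⟩
    just (t (i + (q * length (orbit (t i)) + r))) ∎
    where
    open ≡-Reasoning
    |orbit|≡m = length-orbit (t i)
    r<m : r < m
    r<m = subst (r <_) |orbit|≡m r<len
    qm+r<L′ : q * m + r < L
    qm+r<L′ = subst (λ n → q * n + r < L) |orbit|≡m qm+r<L

  private
    -- A longer run would contain the boundaries after blocks k and k + 1.
    run-bound : ∀ {k d L} → d < b → StepsOn (k * b + d) L → d + L ≤ 2 * b
    run-bound {k} {d} {L} d<b steps with d + L ≤? 2 * b
    ... | yes fits    = fits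
    ... | no too-long = ⊥-elim $ no-consecutive-boundary-steps k
          (subst Step first-boundary (steps j₁ (≤-<-trans (s≤s (m≤m+n j₁ b)) 1+j₂<L)))
          (subst Step second-boundary (steps j₂ 1+j₂<L))
      where
      open ≡-Reasoning
      j₁ = b' ∸ d
      j₂ = j₁ + b
      d+j₁≡b' : d + j₁ ≡ b'
      d+j₁≡b' = m+[n∸m]≡n (≤-pred d<b)
      first-boundary : k * b + d + j₁ ≡ k * b + b'
      first-boundary = trans (+-assoc (k * b) d j₁) (cong (k * b +_) d+j₁≡b')
      second-boundary : k * b + d + j₂ ≡ suc k * b + b'
      second-boundary = begin
        k * b + d + (j₁ + b)  ≡⟨ sym (+-assoc (k * b + d) j₁ b) ⟩
        k * b + d + j₁ + b    ≡⟨ cong (_+ b) first-boundary ⟩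
        k * b + b' + b        ≡⟨ +-comm (k * b + b') b ⟩
        b + (k * b + b')      ≡⟨ sym (+-assoc b (k * b) b') ⟩
        suc k * b + b'        ∎
      d+1+j₂≡2b : d + suc j₂ ≡ 2 * b
      d+1+j₂≡2b = begin
        d + suc (j₁ + b)    ≡⟨ +-suc d (j₁ + b) ⟩
        suc (d + (j₁ + b))  ≡⟨ cong suc (sym (+-assoc d j₁ b)) ⟩
        suc (d + j₁ + b)    ≡⟨ cong (λ n → suc (n + b)) d+j₁≡b' ⟩
        b + b               ≡⟨ cong (b +_) (sym (+-identityʳ b)) ⟩
        2 * b               ∎
      1+j₂<L : suc j₂ < L
      1+j₂<L = +-cancelˡ-< d (suc j₂) L (subst (_< d + L) (sym d+1+j₂≡2b) (≰⇒> too-long))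

  steps-run-bound : ∀ {i L} → StepsOn i L → i % b + L ≤ 2 * b
  steps-run-bound {i} {L} steps =
    run-bound {i / b} (m%n<n i b) (subst (λ n → StepsOn n L) i≡[i/b]b+i%b steps)
    where
    i≡[i/b]b+i%b : i ≡ i / b * b + i % b
    i≡[i/b]b+i%b = trans (m≡m%n+[m/n]*n i b) (+-comm (i % b) (i / b * b))

  private
    boundary-index : ℕ → ℕ
    boundary-index zero    = 0
    boundary-index (suc r) = boundary-index r * b + b'

    t-boundary-index : ∀ r → t (boundary-index r) ≡ iter σ (r * b') (t 0)
    t-boundary-index zero    = refl
    t-boundary-index (suc r) = begin
      t (boundary-index r * b + b')      ≡⟨ fix (boundary-index r) b' ≤-refl ⟩
      iter σ b' (t (boundary-index r))   ≡⟨ cong (iter σ b') (t-boundary-index r) ⟩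
      iter σ b' (iter σ (r * b') (t 0))  ≡⟨ sym (iter-+ σ b' (r * b') (t 0)) ⟩
      iter σ (b' + r * b') (t 0)         ∎
      where open ≡-Reasoning

    t-after-boundary-index : ∀ r → t (suc (boundary-index r)) ≡ σ (t 0)
    t-after-boundary-index zero    = fix 0 1 1<b
    t-after-boundary-index (suc r) = begin
      t (suc (boundary-index r * b + b'))  ≡⟨ cong t (next-block (boundary-index r)) ⟩
      t (suc (boundary-index r) * b + 0)   ≡⟨ fix (suc (boundary-index r)) 0 (s≤s z≤n) ⟩
      t (suc (boundary-index r))           ≡⟨ t-after-boundary-index r ⟩
      σ (t 0)                              ∎
      where open ≡-Reasoning

  -- With J₀ = 0 and J_(r+1) = J_r b + b - 1 one has t[J_r] = σ^(r(b-1))(t[0]) and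
  -- t[J_r + 1] = σ(t[0]); for r = m these differ by a single σ.
  boundary-step-exists : ∃ λ x → Step (x * b + b')
  boundary-step-exists = boundary-index (pred m) , (begin
    t (suc (boundary-index (suc (pred m))))  ≡⟨ t-after-boundary-index (suc (pred m)) ⟩
    σ (t 0)                                   ≡⟨ cong σ (sym (iter-periodic σ m (t 0) (iter-order (t 0)) b' 0)) ⟩
    σ (iter σ (b' * m + 0) (t 0))             ≡⟨ cong (λ n → σ (iter σ n (t 0))) (trans (+-identityʳ (b' * m)) (*-comm b' m)) ⟩
    σ (iter σ (m * b') (t 0))                 ≡⟨ cong (λ n → σ (iter σ (n * b') (t 0))) (sym (suc-pred m)) ⟩
    σ (iter σ (suc (pred m) * b') (t 0))      ≡⟨ cong σ (sym (t-boundary-index (suc (pred m)))) ⟩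
    σ (t (boundary-index (suc (pred m))))     ∎)
    where open ≡-Reasoning

  boundary-step⇒two-block-steps : ∀ x → Step (x * b + b') → StepsOn (x * b) (2 * b)
  boundary-step⇒two-block-steps x step j 1+j<2b with <-cmp j b'
  ... | tri< j<b' _ _ = step-interior x j (s≤s j<b')
  ... | tri≈ _ refl _ = step
  ... | tri> _ _ b'<j = subst Step second-block (step-interior (suc x) (j ∸ b) 1+j-b<b)
    where
    b+[j∸b]≡j : b + (j ∸ b) ≡ j
    b+[j∸b]≡j = m+[n∸m]≡n b'<j
    second-block : suc x * b + (j ∸ b) ≡ x * b + j
    second-block = trans (cong (_+ (j ∸ b)) (+-comm b (x * b)))
      (trans (+-assoc (x * b) b (j ∸ b)) (cong (x * b +_) b+[j∸b]≡j))
    1+j-b<b : suc (j ∸ b) < b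
    1+j-b<b = +-cancelˡ-< b (suc (j ∸ b)) b (subst (_< b + b)
      (trans (sym (cong suc b+[j∸b]≡j)) (sym (+-suc b (j ∸ b)))) (subst (suc j <_) (cong (b +_) (+-identityʳ b)) 1+j<2b))

  -- Two blocks joined by a boundary step are a power of an orbit word of exponent 2b/m.
  critical-bound : ∀ {w L} → IsCritical t w L → 2 * b * length w ≤ L * m
  critical-bound {w} {L} (_ , _ , _ , _ , maximal) with boundary-step-exists
  ... | x , step = subst (λ n → 2 * b * length w ≤ L * n) (length-orbit y)
        (maximal (orbit y) (2 * b) 1≤|orbit| (s≤s z≤n)
          (x * b , steps⇒orbit-power (boundary-step⇒two-block-steps x step)))
    where
    y = t (x * b)
    1≤|orbit| : 1 ≤ length (orbit y)
    1≤|orbit| = subst (1 ≤_) (sym (length-orbit y)) (≤-<-trans z≤n (toℕ<n y))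

  critical-exponent>2 : ∀ {w L} → m < b → IsCritical t w L → 2 * length w < L
  critical-exponent>2 {w} {L} m<b crit with 2 * length w <? L
  ... | yes 2p<L = 2p<L
  ... | no  2p≮L = ⊥-elim (<-irrefl refl (begin-strict
    2 * b * p   ≤⟨ critical-bound {w} crit ⟩
    L * m       ≤⟨ *-monoˡ-≤ m (≮⇒≥ 2p≮L) ⟩
    2 * p * m   <⟨ *-monoʳ-< (2 * p) m<b ⟩
    2 * p * b   ≡⟨ swap 2 p b ⟩
    2 * b * p   ∎))
    where
    open ≤-Reasoning
    p = length w
    instance _ = >-nonZero (≤-trans (proj₁ crit) (m≤m+n p (p + 0)))
    swap : ∀ x y z → x * y * z ≡ x * z * y
    swap = solve-∀

  critical-occurrence-is-two-blocks : ∀ {w L i} → m < b → IsCritical t w L → b ∤ length w →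
    OccursPow t w L i → length w ≡ m × b ∣ i × L ≡ 2 * b
  critical-occurrence-is-two-blocks {w} {L} {i} m<b crit b∤p occ = p≡m , b∣i , L≡2b
    where
    p = length w
    instance _ = >-nonZero (proj₁ crit)
    bound : 2 * b * p ≤ L * m
    bound = critical-bound {w} crit
    2p<L : 2 * p < L
    2p<L = critical-exponent>2 {w} m<b crit
    per : Periodic t i L p
    per = occursPow⇒periodic t w L i occ
    steps : StepsOn i L
    steps = periodic-steps per b∤p λ j j<p L≤j+1+p → ⊥-elim (<⇒≱ 2p<L (begin
      L           ≤⟨ L≤j+1+p ⟩
      j + suc p   ≡⟨ +-suc j p ⟩
      suc j + p   ≤⟨ +-monoˡ-≤ p j<p ⟩
      p + p       ≡⟨ cong (p +_) (sym (+-identityʳ p)) ⟩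
      2 * p       ∎))
      where open ≤-Reasoning
    m≤p : m ≤ p
    m≤p = ∣⇒≤ (steps⇒m∣period steps per (≤-<-trans (m≤m+n p (p + 0)) 2p<L))
    run : i % b + L ≤ 2 * b
    run = steps-run-bound steps
    L≤2b : L ≤ 2 * b
    L≤2b = m+n≤o⇒n≤o (i % b) run
    p≡m : p ≡ m
    p≡m = ≤-antisym (*-cancelˡ-≤ (2 * b) (≤-trans bound (*-monoˡ-≤ m L≤2b))) m≤p
    L≡2b : L ≡ 2 * b
    L≡2b = ≤-antisym L≤2b (*-cancelʳ-≤ (2 * b) L m (subst (λ n → 2 * b * n ≤ L * m) p≡m bound))
    b∣i : b ∣ i
    b∣i = m%n≡0⇒n∣m i b (n≤0⇒n≡0 (+-cancelʳ-≤ (2 * b) (i % b) 0 (subst (λ n → i % b + n ≤ 2 * b) L≡2b run)))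

  square-midpoint-at-block-start : ∀ {w i} → b ≤ m → 1 ≤ length w → b ∤ length w →
    OccursPow t w (2 * length w) i → b ∣ (i + length w)
  square-midpoint-at-block-start {w} {i} b≤m 1≤p b∤p occ with b ∣? (i + length w)
  ... | yes b∣i+p = b∣i+p
  ... | no  b∤i+p = ⊥-elim (<⇒≱ 2b<2p (m+n≤o⇒n≤o (i % b) (steps-run-bound steps)))
    where
    p = length w
    instance _ = >-nonZero 1≤p
    per : Periodic t i (2 * p) p
    per = occursPow⇒periodic t w (2 * p) i occ
    midpoint-step : ∀ j → suc j ≡ p → Step (i + j)
    midpoint-step j 1+j≡p with step-or-boundary (i + j)
    ... | inj₁ step       = step
    ... | inj₂ (k , i+j≡) = ⊥-elim (b∤i+p (divides (suc k) (begin
      i + p              ≡⟨ cong (i +_) (sym 1+j≡p) ⟩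
      i + suc j          ≡⟨ +-suc i j ⟩
      suc (i + j)        ≡⟨ cong suc i+j≡ ⟩
      suc (k * b + b')   ≡⟨ next-block k ⟩
      suc k * b + 0      ≡⟨ +-identityʳ (suc k * b) ⟩
      suc k * b          ∎)))
      where open ≡-Reasoning
    steps : StepsOn i (2 * p)
    steps = periodic-steps per b∤p λ j j<p 2p≤j+1+p → midpoint-step j (≤-antisym j<p
      (+-cancelʳ-≤ p p (suc j) (subst₂ _≤_ (cong (p +_) (+-identityʳ p)) (+-suc j p) 2p≤j+1+p)))
    p<2p : p < 2 * p
    p<2p = subst (p <_) (cong (p +_) (sym (+-identityʳ p))) (m<m+n p 1≤p)
    b<p : b < p
    b<p = ≤∧≢⇒< (≤-trans b≤m (∣⇒≤ (steps⇒m∣period steps per p<2p))) λ b≡p → b∤p (subst (b ∣_) b≡p (divides 1 (sym (+-identityʳ b))))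
    2b<2p : 2 * b < 2 * p
    2b<2p = *-monoʳ-< 2 b<p

lemma5p2 : (b m : ℕ) → 2 ≤ b → 1 ≤ m → m ∤ (b ∸ 1) →
    (σ : Fin m → Fin m) → IsCyclicPerm σ → (α : Fin m) →
    (w : List (Fin m)) (L : ℕ) → IsCritical (tm b σ α) w L → b ∤ length w →
    (m < b → length w ≡ m × (∀ i → OccursPow (tm b σ α) w L i → b ∣ i × L ≡ 2 * b)) ×
    (b ≤ m → ∀ i → OccursPow (tm b σ α) w (2 * length w) i → b ∣ (i + length w))
lemma5p2 zero          _ ()        _ _ _ _ _ _ _ _ _
lemma5p2 (suc zero)    _ (s≤s ()) _ _ _ _ _ _ _ _ _
lemma5p2 b@(suc b'@(suc _)) m 2≤b _ m∤b' σ cyc α w L crit b∤p =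
  (λ m<b → proj₁ (two-blocks m<b i₀ occ₀) , λ i occ → proj₂ (two-blocks m<b i occ)) ,
  (λ b≤m i → square-midpoint-at-block-start {w} {i} b≤m (proj₁ crit) b∤p)
  where
  open FixedPoint σ cyc b' m∤b' (tm b σ α) (tm-fixedPoint b σ α 2≤b) hiding (b)
  i₀ = proj₁ (proj₁ (proj₂ (proj₂ (proj₂ crit))))
  occ₀ = proj₂ (proj₁ (proj₂ (proj₂ (proj₂ crit))))
  two-blocks : m < b → ∀ i → OccursPow (tm b σ α) w L i → length w ≡ m × b ∣ i × L ≡ 2 * b
  two-blocks m<b i = critical-occurrence-is-two-blocks {w} {L} {i} m<b crit b∤p
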